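{- Let $w=a_1^{n_1}a_2uv$ where $a_1\neq a_2$ are letters of $\Sigma$, $u\in\{a_1,a_2\}^+$, $v\in(\Sigma\setminus\{a_1,a_2\})^+$ and $n_1\ge1$. Then there exists an element of $\mathtt{BR}(w)$ which is not rich.
   Context: $\mathtt{BR}(w)=\{B_t\cdots B_1 : w=B_1\cdots B_t,\ t\ge1,\ B_i\in\Sigma^+\}$. A word $w$ is rich if it has exactly $|w|$ distinct non-empty palindromic factors. -}

module Defs where

open import Data.List using (List; []; _∷_; _++_; reverse; concat; length)
open import Data.List.Relation.Unary.All using (All)
open import Data.List.Relation.Unary.Unique.Propositional using (Unique)
open import Data.List.Membership.Propositional using (_∈_)
open import Data.Product using (Σ; ∃; _×_; _,_)
open import Relation.Binary.PropositionalEquality using (_≡_)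
open import Relation.Nullary using (¬_)

NonEmpty : ∀ {A : Set} → List A → Set
NonEmpty xs = ¬ (xs ≡ [])

Factor : ∀ {A : Set} → List A → List A → Set
Factor {A} f w = Σ (List A) λ p → Σ (List A) λ s → p ++ f ++ s ≡ w

Palindrome : ∀ {A : Set} → List A → Set
Palindrome f = reverse f ≡ f

PalFactor : ∀ {A : Set} → List A → List A → Set
PalFactor w f = NonEmpty f × Palindrome f × Factor f w

-- w has exactly |w| distinct non-empty palindromic factors:
-- there is a duplicate-free list enumerating all of them, of length |w|
Rich : ∀ {A : Set} → List A → Set
Rich {A} w = Σ (List (List A)) λ L →
  Unique L × All (PalFactor w) L × (∀ f → PalFactor w f → f ∈ L) × (length L ≡ length w)

InBR : ∀ {A : Set} → List A → List A → Set
InBR {A} z w = Σ (List (List A)) λ Bs →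
  NonEmpty Bs × All NonEmpty Bs × concat Bs ≡ w × z ≡ concat (reverse Bs)

{-# OPTIONS --safe #-}
-- Prepending a letter to a word creates at most one new palindromic factor, its longest
-- palindromic prefix; so a word has at most |w| of them, and fewer as soon as some letter
-- creates none.  Write w = a₁ⁿ a₂ u′ f c v′ with f the last letter of u and c the first of v.
-- Reversing the blocks a₁ⁿ a₂ | u′ f c | v′ (with a₂ split off as a block of its own when
-- f = a₁) gives a word ending in f c y, where y = a₂ a₁ⁿ or y = a₁ⁿ a₂: f occurs in y, c does
-- not, and y does not begin with f.  Hence a palindrome starting with f c would be f c f or
-- would reuse c inside y, so the letter f creates no new palindrome and the word is not rich.
module Submission where

open import Defs
open import Data.Nat using (ℕ; zero; suc; _+_; _≤_; _≥_; z≤n; s≤s)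
open import Data.Nat.Properties using (1+n≰n; +-cancelˡ-≤; module ≤-Reasoning)
open import Data.List using (List; []; _∷_; _++_; _∷ʳ_; replicate; reverse; concat; length; drop; initLast; _∷ʳ′_)
open import Data.List.Properties
  using (++-assoc; ++-identityʳ; ++-conicalˡ; ++-conicalʳ; concat-++; reverse-++; reverse-involutive;
         length-++; length-removeAt′; ∷-injective; ∷-injectiveˡ; ∷-injectiveʳ; ≡-dec)
open import Data.List.Reverse using (Reverse; reverseView; []; _∶_∶ʳ_)
open import Data.List.Relation.Unary.All as All using (All; []; _∷_)
import Data.List.Relation.Unary.All.Properties as All
open import Data.List.Relation.Unary.All.Properties using (All¬⇒¬Any)
open import Data.List.Relation.Unary.Any using (here; there; index; _─_)
open import Data.List.Relation.Unary.Any.Properties using (reverse⁻)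
open import Data.List.Relation.Unary.Unique.Propositional using (Unique)
open import Data.List.Relation.Unary.AllPairs using (_∷_)
open import Data.List.Membership.Propositional using (_∈_; _∉_)
open import Data.List.Membership.Propositional.Properties using (∈-∃++; ∈-++⁺ˡ; ∈-++⁺ʳ)
open import Data.Product using (Σ; ∃; _×_; _,_)
open import Data.Sum as Sum using (_⊎_; inj₁; inj₂; [_,_]′; map₂)
open import Data.Empty using (⊥-elim)
open import Function using (_∘_; case_of_)
open import Relation.Binary.PropositionalEquality using (_≡_; _≢_; ≢-sym; refl; sym; trans; cong; cong₂; subst; subst₂; module ≡-Reasoning)
open import Relation.Binary.Definitions using (DecidableEquality)
open import Relation.Nullary using (¬_; Dec; yes; no)

module _ {X : Set} where

  ∈-─ : ∀ {x y} {M : List X} (x∈M : x ∈ M) → y ∈ M → x ≢ y → y ∈ (M ─ x∈M)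
  ∈-─ (here refl) (here refl) x≢y = ⊥-elim (x≢y refl)
  ∈-─ (here _)    (there y∈M) _   = y∈M
  ∈-─ (there _)   (here y≡)   _   = here y≡
  ∈-─ (there x∈M) (there y∈M) x≢y = there (∈-─ x∈M y∈M x≢y)

  Unique-⊆⇒length≤ : ∀ {L M : List X} → Unique L → (∀ {y} → y ∈ L → y ∈ M) → length L ≤ length M
  Unique-⊆⇒length≤ {[]}    _           _   = z≤n
  Unique-⊆⇒length≤ {x ∷ L} {M} (x∉L ∷ uL) L⊆M = begin
      suc (length L)         ≤⟨ s≤s (Unique-⊆⇒length≤ uL L⊆M─x) ⟩
      suc (length (M ─ x∈M)) ≡⟨ length-removeAt′ M (index x∈M) ⟨
      length M               ∎
    where
    open ≤-Reasoning
    x∈M = L⊆M (here refl)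
    L⊆M─x : ∀ {y} → y ∈ L → y ∈ (M ─ x∈M)
    L⊆M─x y∈L = ∈-─ x∈M (L⊆M (there y∈L)) (All.lookup x∉L y∈L)

module _ {A : Set} where

  Prefix : List A → List A → Set
  Prefix p w = Σ (List A) λ s → p ++ s ≡ w

  PalPrefix : List A → List A → Set
  PalPrefix w p = NonEmpty p × Palindrome p × Prefix p w

  Prefix-∷ʳ : ∀ xs {x p} → Prefix p (xs ∷ʳ x) → p ≡ xs ∷ʳ x ⊎ Prefix p xs
  Prefix-∷ʳ xs       {p = []}    _ = inj₂ (xs , refl)
  Prefix-∷ʳ []       {p = y ∷ p} (s , eq) with refl , p++s≡[] ← ∷-injective eq =
    inj₁ (cong (y ∷_) (++-conicalˡ p s p++s≡[]))
  Prefix-∷ʳ (_ ∷ xs) {p = y ∷ p} (s , eq) with refl , eq′ ← ∷-injective eq =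
    Sum.map (cong (y ∷_)) (λ (s′ , p++s′≡xs) → s′ , cong (y ∷_) p++s′≡xs) (Prefix-∷ʳ xs (s , eq′))

  Factor-∷ : ∀ {c} {x f : List A} → Factor f (c ∷ x) → Prefix f (c ∷ x) ⊎ Factor f x
  Factor-∷ ([]    , s , eq) = inj₁ (s , eq)
  Factor-∷ (_ ∷ p , s , eq) = inj₂ (p , s , ∷-injectiveʳ eq)

  Factor-++ʳ : ∀ {f} (xs ys : List A) → Factor f xs → Factor f (xs ++ ys)
  Factor-++ʳ {f} xs ys (p , s , eq) = p , s ++ ys , (begin
      p ++ f ++ s ++ ys     ≡⟨ cong (p ++_) (++-assoc f s ys) ⟨
      p ++ (f ++ s) ++ ys   ≡⟨ ++-assoc p (f ++ s) ys ⟨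
      (p ++ f ++ s) ++ ys   ≡⟨ cong (_++ ys) eq ⟩
      xs ++ ys              ∎)
    where open ≡-Reasoning

  Factor-drop₁-++ʳ : ∀ {f} (xs ys : List A) → Factor f (drop 1 xs) → Factor f (drop 1 (xs ++ ys))
  Factor-drop₁-++ʳ []       ys (p , s , eq) with refl ← ++-conicalˡ _ s (++-conicalʳ p _ eq) = [] , _ , refl
  Factor-drop₁-++ʳ (_ ∷ xs) ys f∈xs = Factor-++ʳ xs ys f∈xs

  ∈⇒Factor : ∀ {b} {y : List A} → b ∈ y → Factor (b ∷ []) y
  ∈⇒Factor b∈y with ys , zs , eq ← ∈-∃++ b∈y = ys , zs , sym eq

  Palindrome-prefix∈drop₁ : ∀ {p t : List A} → Palindrome p → Palindrome (p ++ t) → NonEmpty t →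
                            Factor p (drop 1 (p ++ t))
  Palindrome-prefix∈drop₁ {p} {t} pal-p pal-pt t≢[] with reverse t in rev-t≡
  ... | []     = ⊥-elim (t≢[] (trans (sym (reverse-involutive t)) (cong reverse rev-t≡)))
  ... | r ∷ rs = subst (Factor p ∘ drop 1) (sym pt≡) (rs , [] , cong (rs ++_) (++-identityʳ p))
    where
    open ≡-Reasoning
    pt≡ : p ++ t ≡ r ∷ rs ++ p
    pt≡ = begin
      p ++ t                  ≡⟨ pal-pt ⟨
      reverse (p ++ t)        ≡⟨ reverse-++ p t ⟩
      reverse t ++ reverse p  ≡⟨ cong₂ _++_ rev-t≡ pal-p ⟩
      r ∷ rs ++ p             ∎

  Palindrome-second-letter : ∀ {b c} {q : List A} → Palindrome (b ∷ c ∷ q) → b ≡ c ⊎ q ≡ b ∷ [] ⊎ c ∈ q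
  Palindrome-second-letter {b} {c} {q} pal = go (reverse q) refl (trans (sym (reverse-++ (b ∷ c ∷ []) q)) pal)
    where
    go : ∀ rq → reverse q ≡ rq → rq ++ c ∷ b ∷ [] ≡ b ∷ c ∷ q → b ≡ c ⊎ q ≡ b ∷ [] ⊎ c ∈ q
    go []             _      eq = inj₁ (sym (∷-injectiveˡ eq))
    go (_ ∷ [])       _      eq = inj₂ (inj₁ (sym (∷-injectiveʳ (∷-injectiveʳ eq))))
    go (_ ∷ r ∷ _)    rev-q≡ eq = inj₂ (inj₂ (reverse⁻ (subst (c ∈_) (sym rev-q≡) (there (here r≡c)))))
      where r≡c = sym (∷-injectiveˡ (∷-injectiveʳ eq))

  palindrome? : DecidableEquality A → (w : List A) → Dec (Palindrome w)
  palindrome? _≟_ w = ≡-dec _≟_ (reverse w) w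

  -- The one exception is the longest palindromic prefix: every shorter one is also its suffix.
  PalPrefix-atMostOneNew : DecidableEquality A → (w : List A) →
                  ∃ λ g → ∀ {p} → PalPrefix w p → p ≡ g ⊎ Factor p (drop 1 w)
  PalPrefix-atMostOneNew _≟_ w = go (reverseView w)
    where
    go : ∀ {w} → Reverse w → ∃ λ g → ∀ {p} → PalPrefix w p → p ≡ g ⊎ Factor p (drop 1 w)
    go [] = [] , λ (p≢[] , _ , s , p++s≡[]) → ⊥-elim (p≢[] (++-conicalˡ _ s p++s≡[]))
    go (xs ∶ xs-view ∶ʳ x) with palindrome? _≟_ (xs ∷ʳ x)
    ... | yes pal-w = xs ∷ʳ x , λ (_ , pal-p , p-pre) → map₂ (proper pal-p) (Prefix-∷ʳ xs p-pre)
      where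
      proper : ∀ {p} → Palindrome p → Prefix p xs → Factor p (drop 1 (xs ∷ʳ x))
      proper {p} pal-p (s , p++s≡xs) =
        subst (Factor p ∘ drop 1) w≡ (Palindrome-prefix∈drop₁ pal-p (subst Palindrome (sym w≡) pal-w) (s∷ʳx≢[] s))
        where
        w≡ : p ++ (s ∷ʳ x) ≡ xs ∷ʳ x
        w≡ = trans (sym (++-assoc p s (x ∷ []))) (cong (_∷ʳ x) p++s≡xs)
        s∷ʳx≢[] : ∀ s → NonEmpty (s ∷ʳ x)
        s∷ʳx≢[] []      ()
        s∷ʳx≢[] (_ ∷ _) ()
    ... | no ¬pal-w with g , new ← go xs-view = g , λ (p≢[] , pal-p , p-pre) → case Prefix-∷ʳ xs p-pre of λ where
      (inj₁ refl)  → ⊥-elim (¬pal-w pal-p)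
      (inj₂ p-pre′) → map₂ (Factor-drop₁-++ʳ xs (x ∷ [])) (new (p≢[] , pal-p , p-pre′))

  PalCover : List A → ℕ → Set
  PalCover w k = Σ (List (List A)) λ M → length M ≤ k × (∀ {f} → PalFactor w f → f ∈ M)

  Rich⇒length≤ : ∀ {w : List A} {k} → Rich w → PalCover w k → length w ≤ k
  Rich⇒length≤ {w} {k} (L , uL , pal-L , _ , |L|≡|w|) (M , |M|≤k , M-covers) = begin
      length w  ≡⟨ |L|≡|w| ⟨
      length L  ≤⟨ Unique-⊆⇒length≤ uL (M-covers ∘ All.lookup pal-L) ⟩
      length M  ≤⟨ |M|≤k ⟩
      k         ∎
    where open ≤-Reasoning

  PalFactor-∷ : ∀ {c} {x f : List A} → PalFactor (c ∷ x) f → PalPrefix (c ∷ x) f ⊎ PalFactor x f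
  PalFactor-∷ (f≢[] , pal-f , f-fac) = Sum.map (λ pre → f≢[] , pal-f , pre) (λ fac → f≢[] , pal-f , fac) (Factor-∷ f-fac)

  PalCover-∷-noNewPrefix : ∀ {c x k} → (∀ {p} → PalPrefix (c ∷ x) p → Factor p x) → PalCover x k → PalCover (c ∷ x) k
  PalCover-∷-noNewPrefix old (M , |M|≤k , M-covers) = M , |M|≤k , λ pf → case PalFactor-∷ pf of λ where
    (inj₁ pp@(p≢[] , pal-p , _)) → M-covers (p≢[] , pal-p , old pp)
    (inj₂ pf′)                   → M-covers pf′

  PalCover-∷ : DecidableEquality A → ∀ {c x k} → PalCover x k → PalCover (c ∷ x) (suc k)
  PalCover-∷ _≟_ {c} {x} (M , |M|≤k , M-covers) with g , new ← PalPrefix-atMostOneNew _≟_ (c ∷ x) =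
    g ∷ M , s≤s |M|≤k , λ pf → case PalFactor-∷ pf of λ where
      (inj₁ pp@(p≢[] , pal-p , _)) → [ here , (λ p-fac → there (M-covers (p≢[] , pal-p , p-fac))) ]′ (new pp)
      (inj₂ pf′)                   → there (M-covers pf′)

  PalCover-length : DecidableEquality A → (w : List A) → PalCover w (length w)
  PalCover-length _≟_ []      = [] , z≤n , λ (f≢[] , _ , p , s , eq) → ⊥-elim (f≢[] (++-conicalˡ _ s (++-conicalʳ p _ eq)))
  PalCover-length _≟_ (c ∷ w) = PalCover-∷ _≟_ (PalCover-length _≟_ w)

  PalCover-++ˡ : DecidableEquality A → ∀ {x k} (y : List A) → PalCover x k → PalCover (y ++ x) (length y + k)
  PalCover-++ˡ _≟_ []      cover = cover
  PalCover-++ˡ _≟_ (c ∷ y) cover = PalCover-∷ _≟_ (PalCover-++ˡ _≟_ y cover)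

  PalPrefix-deficient : ∀ {b c y₀ ys p} → b ≢ c → b ≢ y₀ → b ∈ y₀ ∷ ys → c ∉ y₀ ∷ ys →
                        PalPrefix (b ∷ c ∷ y₀ ∷ ys) p → Factor p (c ∷ y₀ ∷ ys)
  PalPrefix-deficient {p = []}    _ _ _ _ (p≢[] , _) = ⊥-elim (p≢[] refl)
  PalPrefix-deficient {p = _ ∷ []} _ _ b∈y _ (_ , _ , _ , eq) with refl ← ∷-injectiveˡ eq = ∈⇒Factor (there b∈y)
  PalPrefix-deficient {p = _ ∷ _ ∷ q} b≢c b≢y₀ _ c∉y (_ , pal , s , eq)
    with refl ← ∷-injectiveˡ eq | refl ← ∷-injectiveˡ (∷-injectiveʳ eq) = case Palindrome-second-letter pal of λ where
      (inj₁ b≡c)         → ⊥-elim (b≢c b≡c)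
      (inj₂ (inj₁ refl)) → ⊥-elim (b≢y₀ (∷-injectiveˡ q++s≡y))
      (inj₂ (inj₂ c∈q))  → ⊥-elim (c∉y (subst (_ ∈_) q++s≡y (∈-++⁺ˡ c∈q)))
    where q++s≡y = ∷-injectiveʳ (∷-injectiveʳ eq)

  ¬Rich-deficient : DecidableEquality A → ∀ {b c y₀ ys} (x : List A) → b ≢ c → b ≢ y₀ → b ∈ y₀ ∷ ys → c ∉ y₀ ∷ ys →
                    ¬ Rich (x ++ b ∷ c ∷ y₀ ∷ ys)
  ¬Rich-deficient _≟_ {b} {c} {y₀} {ys} x b≢c b≢y₀ b∈y c∉y rich =
    1+n≰n (+-cancelˡ-≤ (length x) _ _ (begin
      length x + length (b ∷ y)  ≡⟨ length-++ x ⟨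
      length (x ++ b ∷ y)        ≤⟨ Rich⇒length≤ rich (PalCover-++ˡ _≟_ x cover) ⟩
      length x + length y        ∎))
    where
    open ≤-Reasoning
    y = c ∷ y₀ ∷ ys
    cover : PalCover (b ∷ y) (length y)
    cover = PalCover-∷-noNewPrefix (PalPrefix-deficient b≢c b≢y₀ b∈y c∉y) (PalCover-length _≟_ y)

  InBR-single : ∀ {w : List A} → NonEmpty w → InBR w w
  InBR-single {w} w≢[] = w ∷ [] , (λ ()) , w≢[] ∷ [] , ++-identityʳ w , sym (++-identityʳ w)

  InBR-++ : ∀ {z w z′ w′ : List A} → InBR z w → InBR z′ w′ → InBR (z′ ++ z) (w ++ w′)
  InBR-++ (Bs , Bs≢[] , Bs-ne , refl , refl) (Cs , _ , Cs-ne , refl , refl) =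
    Bs ++ Cs , Bs≢[] ∘ ++-conicalˡ Bs Cs , All.++⁺ Bs-ne Cs-ne , sym (concat-++ Bs Cs) , (begin
      concat (reverse Cs) ++ concat (reverse Bs)  ≡⟨ concat-++ (reverse Cs) (reverse Bs) ⟩
      concat (reverse Cs ++ reverse Bs)           ≡⟨ cong concat (reverse-++ Bs Cs) ⟨
      concat (reverse (Bs ++ Cs))                 ∎)
    where open ≡-Reasoning

  InBR-++ʳ : ∀ {z w} (v : List A) → InBR z w → InBR (v ++ z) (w ++ v)
  InBR-++ʳ {w = w} []      w↝z = subst (InBR _) (sym (++-identityʳ w)) w↝z
  InBR-++ʳ         (_ ∷ _) w↝z = InBR-++ w↝z (InBR-single (λ ()))

  -- Blocks: those of p ++ a ∷ [], then u ++ f ∷ c ∷ [], then v unless it is empty.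
  InBR-blocks : ∀ {y} (p : List A) a u f c v → InBR y (p ++ a ∷ []) →
                InBR ((v ++ u) ++ f ∷ c ∷ y) (p ++ a ∷ (u ++ f ∷ []) ++ c ∷ v)
  InBR-blocks {y} p a u f c v pa↝y =
    subst₂ InBR z≡ w≡ (InBR-++ʳ v (InBR-++ pa↝y (InBR-single {u ++ f ∷ c ∷ []} ufc≢[])))
    where
    open ≡-Reasoning
    ufc≢[] : NonEmpty (u ++ f ∷ c ∷ [])
    ufc≢[] eq with () ← ++-conicalʳ u _ eq
    z≡ : v ++ (u ++ f ∷ c ∷ []) ++ y ≡ (v ++ u) ++ f ∷ c ∷ y
    z≡ = begin
      v ++ (u ++ f ∷ c ∷ []) ++ y  ≡⟨ cong (v ++_) (++-assoc u (f ∷ c ∷ []) y) ⟩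
      v ++ u ++ f ∷ c ∷ y          ≡⟨ ++-assoc v u (f ∷ c ∷ y) ⟨
      (v ++ u) ++ f ∷ c ∷ y        ∎
    w≡ : ((p ++ a ∷ []) ++ u ++ f ∷ c ∷ []) ++ v ≡ p ++ a ∷ (u ++ f ∷ []) ++ c ∷ v
    w≡ = begin
      ((p ++ a ∷ []) ++ u ++ f ∷ c ∷ []) ++ v  ≡⟨ ++-assoc (p ++ a ∷ []) _ v ⟩
      (p ++ a ∷ []) ++ (u ++ f ∷ c ∷ []) ++ v  ≡⟨ ++-assoc p (a ∷ []) _ ⟩
      p ++ a ∷ (u ++ f ∷ c ∷ []) ++ v          ≡⟨ cong (λ t → p ++ a ∷ t) (++-assoc u (f ∷ c ∷ []) v) ⟩
      p ++ a ∷ u ++ f ∷ c ∷ v                  ≡⟨ cong (λ t → p ++ a ∷ t) (++-assoc u (f ∷ []) (c ∷ v)) ⟨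
      p ++ a ∷ (u ++ f ∷ []) ++ c ∷ v          ∎

lemma3p5 : {A : Set} → DecidableEquality A → (a₁ a₂ : A) → a₁ ≢ a₂ → (n₁ : ℕ) → n₁ ≥ 1 → (u v : List A) → NonEmpty u → All (λ x → x ≡ a₁ ⊎ x ≡ a₂) u → NonEmpty v → All (λ x → x ≢ a₁ × x ≢ a₂) v → Σ (List A) λ z → InBR z (replicate n₁ a₁ ++ a₂ ∷ u ++ v) × ¬ Rich z
lemma3p5 _   _  _  _     zero    ()
lemma3p5 _   _  _  _     (suc _) _  _ []      _ _ v≢[] _ = ⊥-elim (v≢[] refl)
lemma3p5 _≟_ a₁ a₂ a₁≢a₂ (suc m) _  u (c ∷ v) u≢[] u⊆a₁a₂ _ ((c≢a₁ , c≢a₂) ∷ _) with initLast u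
... | []       = ⊥-elim (u≢[] refl)
... | u′ ∷ʳ′ f with All.lookup u⊆a₁a₂ (∈-++⁺ʳ u′ (here refl))
... | inj₁ refl =
  _ , InBR-blocks (replicate (suc m) a₁) a₂ u′ a₁ c v
        (InBR-++ (InBR-single {w = replicate (suc m) a₁} (λ ())) (InBR-single {w = a₂ ∷ []} (λ ()))) ,
  ¬Rich-deficient _≟_ (v ++ u′) (≢-sym c≢a₁) a₁≢a₂ (there (here refl))
    (All¬⇒¬Any (c≢a₂ ∷ c≢a₁ ∷ All.replicate⁺ m c≢a₁))
... | inj₂ refl =
  _ , InBR-blocks (replicate (suc m) a₁) a₂ u′ a₂ c v (InBR-single (λ ())) ,
  ¬Rich-deficient _≟_ (v ++ u′) (≢-sym c≢a₂) (≢-sym a₁≢a₂)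
    (there (∈-++⁺ʳ (replicate m a₁) (here refl)))
    (All¬⇒¬Any (c≢a₁ ∷ All.++⁺ (All.replicate⁺ m c≢a₁) (c≢a₂ ∷ [])))
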